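{- Let $G$ be a finite graph having at least one nonidentity endomorphism, and let $d$ be a positive integer. If $d^{m_e(G)/2} \geq |\operatorname{End}(G)|$, then $D_e(G) \leq d$.
   Context: Graphs are simple. An endomorphism of $G=(V,E)$ is a map $\phi: V\to V$ such that $\phi(u)\phi(v)\in E$ whenever $uv \in E$; $\operatorname{End}(G)$ denotes the set of all endomorphisms. The motion of an endomorphism $\phi$ is $m(\phi) = |\{v \in V : \phi(v) \neq v\}|$, and the endomorphism motion of $G$ is $m_e(G) = \min_{\phi \in \operatorname{End}(G)\setminus\{\mathrm{id}\}} m(\phi)$. A labeling $c$ of $V$ is preserved by $\phi$ if $c(\phi(v)) = c(v)$ for all $v$. The endomorphism distinguishing number $D_e(G)$ is the least cardinal $d$ such that $G$ has a labeling with $d$ labels preserved only by the identity endomorphism. -}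

module Defs where

open import Data.Nat using (ℕ; zero; suc)
open import Data.Fin using (Fin; _≟_)
open import Data.Fin.Properties using (all?)
open import Data.Vec using (Vec; []; _∷_; lookup)
open import Data.List using (List; []; _∷_; length; filter; concatMap; map)
open import Data.List.Base using (allFin)
open import Relation.Nullary using (¬_; Dec; yes; no; ¬?)
open import Relation.Nullary.Decidable using (_→-dec_)
open import Relation.Binary using (Decidable)
open import Relation.Binary.PropositionalEquality using (_≡_)
open import Data.Empty using (⊥)

record Graph (n : ℕ) : Set₁ where
  field
    Adj    : Fin n → Fin n → Set
    adj?   : Decidable Adj
    sym    : ∀ {u v} → Adj u v → Adj v u
    irrefl : ∀ {u} → ¬ Adj u u

module _ {n : ℕ} (G : Graph n) where
  open Graph G

  IsEndo : (Fin n → Fin n) → Set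
  IsEndo φ = ∀ u v → Adj u v → Adj (φ u) (φ v)

  isEndo? : (φ : Fin n → Fin n) → Dec (IsEndo φ)
  isEndo? φ = all? λ u → all? λ v → adj? u v →-dec adj? (φ u) (φ v)

  -- all maps Fin n → Fin n, as their tables of values
  allVecs : (k : ℕ) → List (Vec (Fin n) k)
  allVecs zero = [] ∷ []
  allVecs (suc k) = concatMap (λ x → map (x ∷_) (allVecs k)) (allFin n)

  numEnd : ℕ
  numEnd = length (filter (λ t → isEndo? (lookup t)) (allVecs n))

IsId : {n : ℕ} → (Fin n → Fin n) → Set
IsId φ = ∀ v → φ v ≡ v

motion : {n : ℕ} → (Fin n → Fin n) → ℕ
motion {n} φ = length (filter (λ v → ¬? (φ v ≟ v)) (allFin n))

module _ {n : ℕ} (G : Graph n) where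
  open Data.Nat using (_≤_)

  IsEndoMotion : ℕ → Set
  IsEndoMotion m =
    (Data.Product.Σ (Fin n → Fin n) λ φ → IsEndo G φ Data.Product.× (¬ IsId φ) Data.Product.× motion φ ≡ m)
    Data.Product.× (∀ φ → IsEndo G φ → ¬ IsId φ → m ≤ motion φ)
    where import Data.Product

  Distinguishing : {d : ℕ} → (Fin n → Fin d) → Set
  Distinguishing c = ∀ φ → IsEndo G φ → (∀ v → c (φ v) ≡ c v) → IsId φ

-- A labeling preserved by an endomorphism φ is constant along v ↦ φ v, so it is determined by
-- its values on Up φ = {v | v ≤ φ v} (descend along φ elsewhere), and also by its values on
-- Down φ = {v | φ v ≤ v}. Since |Up φ| + |Down φ| = 2n − m(φ), the number p(φ) of labelings
-- preserved by φ satisfies p(φ)² ≤ d^(2n − m(φ)) ≤ d^(2n − m_e). If no labeling with d labels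
-- were distinguishing, every one of the d^n labelings would be preserved by some nonidentity
-- endomorphism, and summing over the fewer than |End(G)| of them would give
-- d^(2n) ≤ (Σ p(φ))² < |End(G)|² d^(2n − m_e) ≤ d^(2n).
module Submission where

open import Defs
open import Data.Nat using (ℕ; zero; suc; _+_; _*_; _^_; _≤_; _<_; z≤n; s≤s; NonZero)
open import Data.Nat.Properties hiding (_≟_)
open import Data.Nat.ListAction using (sum)
open import Data.Nat.Tactic.RingSolver using (solve-∀)
open import Algebra.Properties.CommutativeMonoid.Sum +-0-commutativeMonoid
  using (sum-syntax; sum-cong-≗; ∑-comm; ∑-distrib-+)
open import Data.Bool using (Bool; true; false; T)
open import Data.Fin using (Fin; zero; suc; _≟_)
import Data.Fin.Properties as Finₚ
open import Data.Fin.Induction using (<-wellFounded; >-wellFounded)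
import Data.List as List
open import Data.Product using (Σ; ∃; _×_; _,_)
open import Data.Sum using (_⊎_; inj₁; inj₂)
open import Data.Empty using (⊥-elim)
open import Function using (_∘_)
open import Induction.WellFounded using (WellFounded; Acc; acc)
open import Relation.Binary using (Rel)
open import Relation.Binary.PropositionalEquality
open import Relation.Nullary using (¬_; Dec; yes; no; does; isYes; ¬?; contradiction)
open import Relation.Nullary.Decidable using (T?; toWitness; fromWitness)
open import Relation.Unary using (Pred; Decidable)

indicator : Bool → ℕ
indicator true = 1
indicator false = 0

indicator≤1 : ∀ b → indicator b ≤ 1
indicator≤1 true = ≤-refl
indicator≤1 false = z≤n

T⇒1≤indicator : ∀ {b} → T b → 1 ≤ indicator b
T⇒1≤indicator {true} _ = ≤-refl

size : ∀ {N} → (Fin N → Bool) → ℕ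
size {N} S = ∑[ v < N ] indicator (S v)

m*m≤n*n⇒m≤n : ∀ {m n} → m * m ≤ n * n → m ≤ n
m*m≤n*n⇒m≤n m*m≤n*n = ≮⇒≥ λ n<m → <⇒≱ (*-mono-< n<m n<m) m*m≤n*n

∑-mono-≤ : ∀ {e} {f g : Fin e → ℕ} → (∀ x → f x ≤ g x) → ∑[ x < e ] f x ≤ ∑[ x < e ] g x
∑-mono-≤ {zero} _ = z≤n
∑-mono-≤ {suc e} f≤g = +-mono-≤ (f≤g zero) (∑-mono-≤ (f≤g ∘ suc))

∑-const : ∀ e k → ∑[ _ < e ] k ≡ e * k
∑-const zero k = refl
∑-const (suc e) k = cong (k +_) (∑-const e k)

∃⊎∑-mono-≤ : ∀ {e} {A : Fin e → Set} {f g : Fin e → ℕ} →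
             (∀ x → A x ⊎ f x ≤ g x) → ∃ A ⊎ ∑[ x < e ] f x ≤ ∑[ x < e ] g x
∃⊎∑-mono-≤ {zero} _ = inj₂ z≤n
∃⊎∑-mono-≤ {suc e} h with h zero | ∃⊎∑-mono-≤ (h ∘ suc)
... | inj₁ a      | _            = inj₁ (zero , a)
... | inj₂ _      | inj₁ (x , a) = inj₁ (suc x , a)
... | inj₂ f₀≤g₀ | inj₂ ∑f≤∑g  = inj₂ (+-mono-≤ f₀≤g₀ ∑f≤∑g)

∑-indicator≡0 : ∀ {e} {g : Fin e → Bool} → (∀ x → ¬ T (g x)) → ∑[ x < e ] indicator (g x) ≡ 0
∑-indicator≡0 {zero} _ = refl
∑-indicator≡0 {suc e} {g} ¬g with g zero | ¬g zero
... | false | _  = ∑-indicator≡0 (¬g ∘ suc)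
... | true  | ¬t = contradiction _ ¬t

∑-indicator≤1 : ∀ {e} {g : Fin e → Bool} → (∀ x y → T (g x) → T (g y) → x ≡ y) →
                ∑[ x < e ] indicator (g x) ≤ 1
∑-indicator≤1 {zero} _ = z≤n
∑-indicator≤1 {suc e} {g} unique with g zero in g₀
... | true  = ≤-reflexive (cong suc (∑-indicator≡0 λ x gx →
              Finₚ.0≢1+n (unique zero (suc x) (subst T (sym g₀) _) gx)))
... | false = ∑-indicator≤1 λ x y gx gy → Finₚ.suc-injective (unique (suc x) (suc y) gx gy)

∑-indicator≤any : ∀ {e} (g : Fin e → Bool) → (∀ x y → T (g x) → T (g y) → x ≡ y) →
                  ∑[ x < e ] indicator (g x) ≤ indicator (isYes (Finₚ.any? (T? ∘ g)))
∑-indicator≤any g unique with Finₚ.any? (T? ∘ g)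
... | yes _  = ∑-indicator≤1 unique
... | no ¬∃g = ≤-reflexive (∑-indicator≡0 λ x gx → ¬∃g (x , gx))

length-filter-tabulate : ∀ {a ℓ} {A : Set a} {P : Pred A ℓ} (P? : Decidable P) {N} (f : Fin N → A) →
                         List.length (List.filter P? (List.tabulate f)) ≡
                         ∑[ i < N ] indicator (does (P? (f i)))
length-filter-tabulate P? {zero} f = refl
length-filter-tabulate P? {suc N} f with does (P? (f zero))
... | true  = cong suc (length-filter-tabulate P? (f ∘ suc))
... | false = length-filter-tabulate P? (f ∘ suc)

module _ {n} (φ : Fin n → Fin n) where
  Up Down moved : Fin n → Bool
  Up v = isYes (v Finₚ.≤? φ v)
  Down v = isYes (φ v Finₚ.≤? v)
  moved v = does (¬? (φ v ≟ v))

  up+down+moved : ∀ v → indicator (Up v) + indicator (Down v) + indicator (moved v) ≡ 2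
  up+down+moved v with v Finₚ.≤? φ v | φ v Finₚ.≤? v | φ v ≟ v
  ... | yes _    | yes _    | yes _    = refl
  ... | yes _    | no _     | no _     = refl
  ... | no _     | yes _    | no _     = refl
  ... | yes v≤φv | yes φv≤v | no φv≢v  = contradiction (Finₚ.≤-antisym φv≤v v≤φv) φv≢v
  ... | _        | no φv≰v  | yes φv≡v = contradiction (Finₚ.≤-reflexive φv≡v) φv≰v
  ... | no v≰φv  | _        | yes φv≡v = contradiction (Finₚ.≤-reflexive (sym φv≡v)) v≰φv
  ... | no v≰φv  | no φv≰v  | no _     = contradiction (<⇒≤ (≰⇒> v≰φv)) φv≰v

  size-up+size-down+motion : size Up + size Down + motion φ ≡ n + n
  size-up+size-down+motion = begin
    size Up + size Down + motion φ
      ≡⟨ cong (size Up + size Down +_) (length-filter-tabulate (λ v → ¬? (φ v ≟ v)) (λ v → v)) ⟩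
    size Up + size Down + size moved
      ≡⟨ cong (_+ size moved) (∑-distrib-+ (indicator ∘ Up) (indicator ∘ Down)) ⟨
    ∑[ v < n ] (indicator (Up v) + indicator (Down v)) + size moved
      ≡⟨ ∑-distrib-+ (λ v → indicator (Up v) + indicator (Down v)) (indicator ∘ moved) ⟨
    ∑[ v < n ] (indicator (Up v) + indicator (Down v) + indicator (moved v))
      ≡⟨ sum-cong-≗ up+down+moved ⟩
    ∑[ _ < n ] 2
      ≡⟨ ∑-const n 2 ⟩
    n * 2
      ≡⟨ trans (*-comm n 2) (cong (n +_) (+-identityʳ n)) ⟩
    n + n ∎
    where open ≡-Reasoning

module Labelings (d : ℕ) where
  open import Data.Vec.Functional using ([]; _∷_)

  Labeling : ℕ → Set
  Labeling N = Fin N → Fin d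

  total : ∀ N → (Labeling N → ℕ) → ℕ
  total zero f = f []
  total (suc N) f = ∑[ x < d ] total N (λ c → f (x ∷ c))

  count : ∀ N → (Labeling N → Bool) → ℕ
  count N P = total N (λ c → indicator (P c))

  total-mono-≤ : ∀ N {f g : Labeling N → ℕ} → (∀ c → f c ≤ g c) → total N f ≤ total N g
  total-mono-≤ zero f≤g = f≤g _
  total-mono-≤ (suc N) f≤g = ∑-mono-≤ λ x → total-mono-≤ N λ c → f≤g (x ∷ c)

  total-const : ∀ N k → total N (λ _ → k) ≡ d ^ N * k
  total-const zero k = sym (+-identityʳ k)
  total-const (suc N) k = begin
    ∑[ _ < d ] total N (λ _ → k) ≡⟨ sum-cong-≗ {d} (λ _ → total-const N k) ⟩
    ∑[ _ < d ] (d ^ N * k)       ≡⟨ ∑-const d (d ^ N * k) ⟩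
    d * (d ^ N * k)              ≡⟨ *-assoc d (d ^ N) k ⟨
    d ^ suc N * k                ∎
    where open ≡-Reasoning

  total-distrib-+ : ∀ N (f g : Labeling N → ℕ) → total N (λ c → f c + g c) ≡ total N f + total N g
  total-distrib-+ zero f g = refl
  total-distrib-+ (suc N) f g =
    trans (sum-cong-≗ {d} λ x → total-distrib-+ N _ _)
          (∑-distrib-+ (λ x → total N (λ c → f (x ∷ c))) (λ x → total N (λ c → g (x ∷ c))))

  total-∑ : ∀ N {e} (g : Fin e → Labeling N → ℕ) →
            total N (λ c → ∑[ x < e ] g x c) ≡ ∑[ x < e ] total N (g x)
  total-∑ zero g = refl
  total-∑ (suc N) {e} g =
    trans (sum-cong-≗ {d} λ y → total-∑ N (λ x c → g x (y ∷ c)))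
          (∑-comm λ y x → total N (λ c → g x (y ∷ c)))

  zero⊎^≤total : ∀ N (f : Labeling N → ℕ) → (∃ λ c → f c ≡ 0) ⊎ d ^ N ≤ total N f
  zero⊎^≤total zero f with f [] in f≡
  ... | zero  = inj₁ (_ , f≡)
  ... | suc _ = inj₂ (s≤s z≤n)
  zero⊎^≤total (suc N) f with ∃⊎∑-mono-≤ (λ x → zero⊎^≤total N (λ c → f (x ∷ c)))
  ... | inj₁ (x , c , fc≡0) = inj₁ (x ∷ c , fc≡0)
  ... | inj₂ ∑≤total        = inj₂ (≤-trans (≤-reflexive (sym (∑-const d (d ^ N)))) ∑≤total)

  Agree : ∀ {N} → (Fin N → Bool) → Labeling N → Labeling N → Set
  Agree S c c′ = ∀ v → T (S v) → c v ≡ c′ v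

  Determines : ∀ {N} → (Fin N → Bool) → (Labeling N → Bool) → Set
  Determines S P = ∀ c c′ → T (P c) → T (P c′) → Agree S c c′ → c ≗ c′

  count≤^size : ∀ N {S P} → Determines S P → count N P ≤ d ^ size S
  count≤^size zero {P = P} _ = indicator≤1 (P [])
  count≤^size (suc N) {S} {P} determines with S zero in S₀
  ... | true = begin
      ∑[ x < d ] count N (λ c → P (x ∷ c)) ≤⟨ ∑-mono-≤ (λ x → count≤^size N (tail-determined x)) ⟩
      ∑[ _ < d ] (d ^ size (S ∘ suc))      ≡⟨ ∑-const d _ ⟩
      d * d ^ size (S ∘ suc)               ∎
    where
    open ≤-Reasoning
    tail-determined : ∀ x → Determines (S ∘ suc) (λ c → P (x ∷ c))
    tail-determined x c c′ p p′ agree v =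
      determines (x ∷ c) (x ∷ c′) p p′ (λ { zero _ → refl ; (suc v) s → agree v s }) (suc v)
  -- With 0 ∉ S, a labeling satisfying P is determined by its tail, which is Extendable.
  ... | false = begin
      ∑[ x < d ] count N (λ c → P (x ∷ c))
        ≡⟨ total-∑ N (λ x c → indicator (P (x ∷ c))) ⟨
      total N (λ c → ∑[ x < d ] indicator (P (x ∷ c)))
        ≤⟨ total-mono-≤ N (λ c → ∑-indicator≤any (λ x → P (x ∷ c)) (unique c)) ⟩
      count N Extendable
        ≤⟨ count≤^size N extendable-determined ⟩
      d ^ size (S ∘ suc) ∎
    where
    open ≤-Reasoning
    extendable? : (c : Labeling N) → Dec (∃ λ x → T (P (x ∷ c)))
    extendable? c = Finₚ.any? λ x → T? (P (x ∷ c))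
    Extendable : Labeling N → Bool
    Extendable c = isYes (extendable? c)
    ¬S₀ : ¬ T (S zero)
    ¬S₀ = subst T S₀
    unique : ∀ c x y → T (P (x ∷ c)) → T (P (y ∷ c)) → x ≡ y
    unique c x y px py =
      determines (x ∷ c) (y ∷ c) px py (λ { zero s → ⊥-elim (¬S₀ s) ; (suc _) _ → refl }) zero
    extendable-determined : Determines (S ∘ suc) Extendable
    extendable-determined c c′ e e′ agree v
      with toWitness {a? = extendable? c} e | toWitness {a? = extendable? c′} e′
    ... | x , px | x′ , px′ =
      determines (x ∷ c) (x′ ∷ c′) px px′ (λ { zero s → ⊥-elim (¬S₀ s) ; (suc v) s → agree v s }) (suc v)

  module _ {n} (φ : Fin n → Fin n) where
    preserves? : (c : Labeling n) → Dec (∀ v → c (φ v) ≡ c v)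
    preserves? c = Finₚ.all? λ v → c (φ v) ≟ c v

    preserves : Labeling n → Bool
    preserves c = isYes (preserves? c)

    preserves-determined : ∀ {ℓ} {_≺_ : Rel (Fin n) ℓ} → WellFounded _≺_ →
                           (S : Fin n → Bool) → (∀ v → ¬ T (S v) → φ v ≺ v) → Determines S preserves
    preserves-determined {_≺_ = _≺_} wf S descends c c′ p p′ agree v = go v (wf v)
      where
      go : ∀ v → Acc _≺_ v → c v ≡ c′ v
      go v (acc rs) with T? (S v)
      ... | yes s  = agree v s
      ... | no ¬s  = begin
        c v       ≡⟨ toWitness {a? = preserves? c} p v ⟨
        c (φ v)   ≡⟨ go (φ v) (rs (descends v ¬s)) ⟩
        c′ (φ v)  ≡⟨ toWitness {a? = preserves? c′} p′ v ⟩
        c′ v      ∎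
        where open ≡-Reasoning

    up-determines : Determines (Up φ) preserves
    up-determines = preserves-determined <-wellFounded (Up φ) λ v ¬up → ≰⇒> (¬up ∘ fromWitness)

    down-determines : Determines (Down φ) preserves
    down-determines = preserves-determined >-wellFounded (Down φ) λ v ¬down → ≰⇒> (¬down ∘ fromWitness)

    count-preserves² : count n preserves * count n preserves * d ^ motion φ ≤ d ^ (n + n)
    count-preserves² = begin
      count n preserves * count n preserves * d ^ motion φ
        ≤⟨ *-monoˡ-≤ (d ^ motion φ)
             (*-mono-≤ (count≤^size n {Up φ} up-determines) (count≤^size n {Down φ} down-determines)) ⟩
      d ^ size (Up φ) * d ^ size (Down φ) * d ^ motion φ
        ≡⟨ cong (_* d ^ motion φ) (^-distribˡ-+-* d (size (Up φ)) (size (Down φ))) ⟨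
      d ^ (size (Up φ) + size (Down φ)) * d ^ motion φ
        ≡⟨ ^-distribˡ-+-* d (size (Up φ) + size (Down φ)) (motion φ) ⟨
      d ^ (size (Up φ) + size (Down φ) + motion φ)
        ≡⟨ cong (d ^_) (size-up+size-down+motion φ) ⟩
      d ^ (n + n) ∎
      where open ≤-Reasoning

-- Imported after Labelings, whose functional-vector _∷_ would clash with these constructors.
open import Data.Vec using (Vec; []; _∷_; lookup; tabulate)
open import Data.Vec.Properties using (lookup∘tabulate)
open import Data.List using (List; []; _∷_; map; length; filter)
open import Data.List.Properties using (length-map; filter-notAll)
open import Data.List.Relation.Unary.All as All using (All; []; _∷_)
open import Data.List.Relation.Unary.All.Properties using (all-filter; filter⁺; map⁺)
open import Data.List.Relation.Unary.Any using (here; there)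
open import Data.List.Membership.Propositional using (_∈_; lose)
open import Data.List.Membership.Propositional.Properties
  using (∈-concatMap⁺; ∈-map⁺; ∈-allFin; ∈-filter⁺)

∈⇒≤sum : ∀ {a} {A : Set a} {t : A} {ts : List A} (g : A → ℕ) → t ∈ ts → g t ≤ sum (map g ts)
∈⇒≤sum g (here refl) = m≤m+n _ _
∈⇒≤sum {ts = t′ ∷ _} g (there t∈ts) = ≤-trans (∈⇒≤sum g t∈ts) (m≤n+m _ (g t′))

sum-square-bound : ∀ {D Q} (xs : List ℕ) → All (λ x → x * x * D ≤ Q) xs →
                   sum xs * sum xs * D ≤ length xs * length xs * Q
sum-square-bound [] [] = z≤n
sum-square-bound {D} {Q} (x ∷ xs) (x²≤ ∷ xs²≤) = begin
  (x + s) * (x + s) * D                          ≡⟨ expand x s D ⟩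
  x * x * D + (x * s * D + x * s * D) + s * s * D ≤⟨ +-mono-≤ (+-mono-≤ x²≤ (+-mono-≤ cross cross)) ih ⟩
  Q + (k * Q + k * Q) + k * k * Q                 ≡⟨ expand′ k Q ⟨
  suc k * suc k * Q                               ∎
  where
  open ≤-Reasoning
  s = sum xs
  k = length xs
  ih : s * s * D ≤ k * k * Q
  ih = sum-square-bound xs xs²≤
  expand : ∀ x s D → (x + s) * (x + s) * D ≡ x * x * D + (x * s * D + x * s * D) + s * s * D
  expand = solve-∀
  expand′ : ∀ k Q → suc k * suc k * Q ≡ Q + (k * Q + k * Q) + k * k * Q
  expand′ = solve-∀
  -- the cross term is bounded through its square: (x s D)² = (x² D)(s² D) ≤ Q · k² Q
  cross : x * s * D ≤ k * Q
  cross = m*m≤n*n⇒m≤n (begin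
    (x * s * D) * (x * s * D) ≡⟨ regroup x s D ⟩
    (x * x * D) * (s * s * D) ≤⟨ *-mono-≤ x²≤ ih ⟩
    Q * (k * k * Q)           ≡⟨ regroup′ k Q ⟩
    (k * Q) * (k * Q)         ∎)
    where
    regroup : ∀ x s D → (x * s * D) * (x * s * D) ≡ (x * x * D) * (s * s * D)
    regroup = solve-∀
    regroup′ : ∀ k Q → Q * (k * k * Q) ≡ (k * Q) * (k * Q)
    regroup′ = solve-∀

module _ (d : ℕ) where
  open Labelings d

  total-sum : ∀ {a} {A : Set a} {N} (ts : List A) (g : A → Labeling N → ℕ) →
              total N (λ c → sum (map (λ t → g t c) ts)) ≡ sum (map (λ t → total N (g t)) ts)
  total-sum {N = N} [] g = trans (total-const N 0) (*-zeroʳ (d ^ N))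
  total-sum {N = N} (t ∷ ts) g =
    trans (total-distrib-+ N (g t) _) (cong (total N (g t) +_) (total-sum ts g))

∈-allVecs : ∀ {n} (G : Graph n) k (t : Vec (Fin n) k) → t ∈ allVecs G k
∈-allVecs G zero [] = here refl
∈-allVecs G (suc k) (x ∷ t) =
  ∈-concatMap⁺ (λ x → map (x ∷_) (allVecs G k)) (lose (∈-allFin x) (∈-map⁺ (x ∷_) (∈-allVecs G k t)))

isId? : ∀ {n} (φ : Fin n → Fin n) → Dec (IsId φ)
isId? φ = Finₚ.all? λ v → φ v ≟ v

module _ {n} (G : Graph n) where
  open Graph G using (Adj)

  IsEndo-resp-≗ : ∀ {φ ψ} → φ ≗ ψ → IsEndo G φ → IsEndo G ψ
  IsEndo-resp-≗ φ≗ψ endo u v uv = subst₂ Adj (φ≗ψ u) (φ≗ψ v) (endo u v uv)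

  endomorphisms : List (Vec (Fin n) n)
  endomorphisms = filter (λ t → isEndo? G (lookup t)) (allVecs G n)

  nonIdentityEndos : List (Vec (Fin n) n)
  nonIdentityEndos = filter (λ t → ¬? (isId? (lookup t))) endomorphisms

  tabulate∈endomorphisms : ∀ {φ} → IsEndo G φ → tabulate φ ∈ endomorphisms
  tabulate∈endomorphisms {φ} endo =
    ∈-filter⁺ _ (∈-allVecs G n (tabulate φ)) (IsEndo-resp-≗ (sym ∘ lookup∘tabulate φ) endo)

  tabulate∈nonIdentityEndos : ∀ {φ} → IsEndo G φ → ¬ IsId φ → tabulate φ ∈ nonIdentityEndos
  tabulate∈nonIdentityEndos {φ} endo ¬id =
    ∈-filter⁺ _ (tabulate∈endomorphisms endo) λ id → ¬id λ v → trans (sym (lookup∘tabulate φ v)) (id v)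

  length-nonIdentityEndos<numEnd : length nonIdentityEndos < numEnd G
  length-nonIdentityEndos<numEnd = filter-notAll _ endomorphisms
    (lose (tabulate∈endomorphisms (λ _ _ uv → uv)) λ ¬id → ¬id (lookup∘tabulate (λ v → v)))

  module _ (d : ℕ) .{{_ : NonZero d}} where
    open Labelings d

    preservers : Labeling n → ℕ
    preservers c = sum (map (λ t → indicator (preserves (lookup t) c)) nonIdentityEndos)

    preservers≡0⇒distinguishing : ∀ c → preservers c ≡ 0 → Distinguishing G c
    preservers≡0⇒distinguishing c none φ endo φ-preserves with isId? φ
    ... | yes id = id
    ... | no ¬id = contradiction (≤-trans fixed (≤-reflexive none)) λ ()
      where
      fixed : 1 ≤ preservers c
      fixed = ≤-trans
        (T⇒1≤indicator (fromWitness {a? = preserves? (lookup (tabulate φ)) c}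
          λ v → trans (cong c (lookup∘tabulate φ v)) (φ-preserves v)))
        (∈⇒≤sum (λ t → indicator (preserves (lookup t) c)) (tabulate∈nonIdentityEndos endo ¬id))

    module _ (m : ℕ) (m≤motion : ∀ φ → IsEndo G φ → ¬ IsId φ → m ≤ motion φ) where
      private
        k = length nonIdentityEndos
        counts = map (λ t → count n (preserves (lookup t))) nonIdentityEndos

      total-preservers² : total n preservers * total n preservers * d ^ m ≤ k * k * d ^ (n + n)
      total-preservers² = subst₂ (λ s k → s * s * d ^ m ≤ k * k * d ^ (n + n))
        (sym (total-sum d nonIdentityEndos λ t c → indicator (preserves (lookup t) c)))
        (length-map _ nonIdentityEndos)
        (sum-square-bound counts (map⁺ (All.zipWith (λ {t} → bounded {t})
          (filter⁺ _ (all-filter _ (allVecs G n)) , all-filter _ endomorphisms))))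
        where
        bounded : ∀ {t} → IsEndo G (lookup t) × ¬ IsId (lookup t) →
                  count n (preserves (lookup t)) * count n (preserves (lookup t)) * d ^ m ≤ d ^ (n + n)
        bounded {t} (endo , ¬id) = ≤-trans
          (*-monoʳ-≤ (p * p) (^-monoʳ-≤ d (m≤motion (lookup t) endo ¬id)))
          (count-preserves² (lookup t))
          where p = count n (preserves (lookup t))

      numEnd≤length-nonIdentityEndos : d ^ n ≤ total n preservers → numEnd G * numEnd G ≤ d ^ m →
                                       numEnd G ≤ k
      numEnd≤length-nonIdentityEndos dⁿ≤total numEnd²≤dᵐ =
        m*m≤n*n⇒m≤n (≤-trans numEnd²≤dᵐ (*-cancelˡ-≤ (d ^ (n + n)) {{m^n≢0 d (n + n)}} (begin
          d ^ (n + n) * d ^ m     ≡⟨ cong (_* d ^ m) (^-distribˡ-+-* d n n) ⟩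
          d ^ n * d ^ n * d ^ m   ≤⟨ *-monoˡ-≤ (d ^ m) (*-mono-≤ dⁿ≤total dⁿ≤total) ⟩
          s * s * d ^ m           ≤⟨ total-preservers² ⟩
          k * k * d ^ (n + n)     ≡⟨ *-comm (k * k) (d ^ (n + n)) ⟩
          d ^ (n + n) * (k * k)   ∎)))
        where
        open ≤-Reasoning
        s = total n preservers

lemma2 : (n : ℕ) (G : Graph n)
         → Σ (Fin n → Fin n) (λ φ → IsEndo G φ × ¬ IsId φ)
         → (d : ℕ) → .{{_ : NonZero d}}
         → (m : ℕ) → IsEndoMotion G m
         → numEnd G * numEnd G ≤ d ^ m
         → Σ (Fin n → Fin d) (λ c → Distinguishing G c)
lemma2 n G _ d m (_ , m≤motion) numEnd²≤dᵐ
  with Labelings.zero⊎^≤total d n (preservers G d)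
... | inj₁ (c , none) = c , preservers≡0⇒distinguishing G d c none
... | inj₂ dⁿ≤total = contradiction
  (numEnd≤length-nonIdentityEndos G d m m≤motion dⁿ≤total numEnd²≤dᵐ)
  (<⇒≱ (length-nonIdentityEndos<numEnd G))
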